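{- Let $t,r$ be positive integers, $m=tr$, $n=2m$. For $a\in\mathbb{F}_{2^r}$ and $b\in\mathbb{F}_{2^n}$ let $B_{a,b}\in\mathbb{R}^{2^n}$ be the vector indexed by $x\in\mathbb{F}_{2^n}$ with $x$-coordinate $\frac{1}{2^m}(-1)^{\mathrm{Tr}_1^m(a x^{2^m+1})+\mathrm{Tr}_1^n(bx)}$. Then for any $a_1,a_2\in\mathbb{F}_{2^r}$ with $a_1\ne a_2$ and any $b_1,b_2\in\mathbb{F}_{2^n}$, we have $|\langle B_{a_1,b_1},B_{a_2,b_2}\rangle|=\frac{1}{2^m}$.
   Context: For integers $k\mid \ell$ and $z\in\mathbb{F}_{2^\ell}$, the trace is $\mathrm{Tr}_k^\ell(z)=z+z^{2^k}+\cdots+z^{2^{\ell-k}}\in\mathbb{F}_{2^k}$; values of $\mathrm{Tr}_1^\ell$ lie in $\mathbb{F}_2=\{0,1\}$ and are used as exponents of $-1$. Here $\mathbb{F}_{2^r}\subseteq\mathbb{F}_{2^m}\subseteq\mathbb{F}_{2^n}$. Vectors in $\mathbb{R}^{2^n}$ have coordinates indexed by the elements of $\mathbb{F}_{2^n}$, with the standard inner product. -}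

module Defs where

open import Level using (0ℓ)
open import Data.Nat as ℕ using (ℕ; zero; suc)
open import Data.Fin using (Fin; zero; suc)
open import Data.Rational as ℚ using (ℚ; 0ℚ; 1ℚ; ½)
open import Data.Empty using (⊥)
open import Data.Product using (∃)
open import Relation.Nullary using (¬_; yes; no)
open import Relation.Binary.PropositionalEquality using (_≡_)
open import Relation.Binary.Definitions using (DecidableEquality)
open import Algebra.Structures using (IsCommutativeRing)
open import Function.Bundles using (_↔_)

record GF (n : ℕ) : Set₁ where
  infixl 6 _+_
  infixl 7 _*_
  field
    Carrier : Set
    _+_ _*_ : Carrier → Carrier → Carrier
    -_ : Carrier → Carrier
    0# 1# : Carrier
    isCommutativeRing : IsCommutativeRing _≡_ _+_ _*_ -_ 0# 1#
    0≢1 : ¬ (0# ≡ 1#)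
    inverse : ∀ x → ¬ (x ≡ 0#) → ∃ λ y → x * y ≡ 1#
    _≟_ : DecidableEquality Carrier
    enum : Fin (2 ℕ.^ n) ↔ Carrier

  _^_ : Carrier → ℕ → Carrier
  x ^ zero = 1#
  x ^ suc k = x * (x ^ k)

  Tr₁ : ℕ → Carrier → Carrier
  Tr₁ zero z = 0#
  Tr₁ (suc ℓ) z = Tr₁ ℓ z + z ^ (2 ℕ.^ ℓ)

  -- membership in the subfield F_{2^k}
  InSub : ℕ → Carrier → Set
  InSub k z = z ^ (2 ℕ.^ k) ≡ z

  -- (-1)^e for e ∈ F_2 ⊆ F_{2^n}, as a rational number
  sign : Carrier → ℚ
  sign e with e ≟ 0#
  ... | yes _ = 1ℚ
  ... | no _ = ℚ.- 1ℚ

  Σ : (Carrier → ℚ) → ℚ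
  Σ f = go (2 ℕ.^ n) (λ i → f (Function.Bundles.Inverse.to enum i))
    where
    go : (k : ℕ) → (Fin k → ℚ) → ℚ
    go zero g = 0ℚ
    go (suc k) g = g zero ℚ.+ go k (λ i → g (suc i))

  -- standard inner product on ℚ^{F_{2^n}} ⊆ ℝ^{2^n}
  ⟪_,_⟫ : (Carrier → ℚ) → (Carrier → ℚ) → ℚ
  ⟪ u , v ⟫ = Σ (λ x → u x ℚ.* v x)

½^ : ℕ → ℚ
½^ zero = 1ℚ
½^ (suc k) = ½ ℚ.* ½^ k

module _ {n : ℕ} (F : GF n) where
  open GF F
  B : (m : ℕ) → Carrier → Carrier → Carrier → ℚ
  B m a b x = ½^ m ℚ.* (sign (Tr₁ m (a * x ^ (2 ℕ.^ m ℕ.+ 1)) + Tr₁ n (b * x)))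

{-# OPTIONS --safe #-}
module Submission where

-- Put a = a₁ + a₂ ≠ 0 and b = b₁ + b₂. Then ⟨B_{a₁,b₁}, B_{a₂,b₂}⟩ = 2^{-2m} W with
-- W = Σₓ (-1)^{φ(x)}, φ(x) = Tr_1^m(a x^{2^m+1}) + Tr_1^n(b x), and φ(x) ∈ F₂ since a x^{2^m+1} ∈ F_{2^m}.
-- As a ∈ F_{2^m}, the polarisation φ(x + z) - φ(x) - φ(z) = Tr_1^n(a z^{2^m} x) is linear in x, so
-- W² = Σ_z (-1)^{φ(z)} Σₓ (-1)^{Tr_1^n(a z^{2^m} x)}, and by orthogonality of the additive character
-- only z = 0 survives: W² = 2^n, whence |⟨B, B⟩| = 2^{-2m} 2^m = 2^{-m}.
-- The finite-field input is derived from the field axioms and the count 2^n: translation invariance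
-- of Σ y gives characteristic 2, permuting the factors of ∏_{y ≠ 0} y gives x^{2^n} = x, and the trace
-- is nontrivial because it is a polynomial of degree 2^{n-1} < 2^n.

open import Defs
open import Level using (0ℓ)
open import Function using (id; _∘_)
open import Function.Bundles using (Inverse; Injection; _↔_; mk↔ₛ′)
open import Function.Construct.Composition using (_↔-∘_)
open import Function.Construct.Symmetry using (↔-sym)
open import Function.Properties.Inverse using (↔⇒↣)
open import Relation.Nullary using (¬_; yes; no)
open import Relation.Binary.Definitions using (tri<; tri≈; tri>)
open import Relation.Binary.PropositionalEquality hiding ([_])
import Relation.Binary.Reasoning.Setoid as ≈-Reasoning
open import Data.Empty using (⊥-elim)
open import Data.Sum using (_⊎_; inj₁; inj₂; [_,_]; [_,_]′)
import Data.Sum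
open import Data.Product using (∃; _,_; proj₁; proj₂)
open import Data.Maybe using (nothing)
open import Data.Nat as ℕ using (ℕ; zero; suc)
import Data.Nat.Properties as ℕₚ
open import Data.Nat.Divisibility using (_∣_; divides)
open import Data.Rational as ℚ using (ℚ; 0ℚ; 1ℚ; ½)
import Data.Rational.Properties as ℚₚ
open import Data.Rational.Solver using (module +-*-Solver)
open import Data.Fin using (Fin; zero; suc)
open import Data.Fin.Properties using (punchInᵢ≢i)
open import Data.Vec.Functional using (removeAt)
open import Data.List using (List; []; _∷_; length; tabulate)
import Data.List.Properties
open import Data.List.Relation.Unary.All as All using (All; []; _∷_)
open import Data.List.Relation.Unary.All.Properties using (¬All⇒Any¬)
import Data.List.Relation.Unary.Any as Any
open import Data.List.Relation.Unary.AllPairs using ([]; _∷_)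
open import Data.List.Relation.Unary.Unique.Propositional using (Unique)
import Data.List.Relation.Unary.Unique.Propositional.Properties as Unique
open import Algebra.Bundles using (CommutativeRing; CommutativeMonoid)
import Algebra.Properties.CommutativeSemigroup
import Algebra.Properties.Semiring.Mult
import Algebra.Properties.Semiring.Sum

module ℚ-Mult = Algebra.Properties.Semiring.Mult (CommutativeRing.semiring ℚₚ.+-*-commutativeRing)
module ℚ-* = Algebra.Properties.CommutativeSemigroup
  (CommutativeMonoid.commutativeSemigroup ℚₚ.*-1-commutativeMonoid)
module ℚ-Sum = Algebra.Properties.Semiring.Sum (CommutativeRing.semiring ℚₚ.+-*-commutativeRing)

½^-nonNeg : ∀ k → 0ℚ ℚ.≤ ½^ k
½^-nonNeg zero = ℚₚ.nonNegative⁻¹ 1ℚ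
½^-nonNeg (suc k) =
  ℚₚ.nonNegative⁻¹ _ {{ℚₚ.nonNeg*nonNeg⇒nonNeg ½ (½^ k) {{ℚ.nonNegative (½^-nonNeg k)}}}}

½^*2^≡1 : ∀ k → ½^ k ℚ.* ((2 ℕ.^ k) ℚ-Mult.× 1ℚ) ≡ 1ℚ
½^*2^≡1 zero = refl
½^*2^≡1 (suc k) = begin
  (½ ℚ.* ½^ k) ℚ.* ((2 ℕ.* 2 ℕ.^ k) ℚ-Mult.× 1ℚ)  ≡⟨ cong ((½ ℚ.* ½^ k) ℚ.*_) (ℚ-Mult.×1-homo-* 2 (2 ℕ.^ k)) ⟩
  (½ ℚ.* ½^ k) ℚ.* ((2 ℚ-Mult.× 1ℚ) ℚ.* N)        ≡⟨ ℚ-*.interchange ½ (½^ k) (2 ℚ-Mult.× 1ℚ) N ⟩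
  (½ ℚ.* (2 ℚ-Mult.× 1ℚ)) ℚ.* (½^ k ℚ.* N)        ≡⟨ cong (1ℚ ℚ.*_) (½^*2^≡1 k) ⟩
  1ℚ ∎
  where
  open ≡-Reasoning
  N = (2 ℕ.^ k) ℚ-Mult.× 1ℚ

p≡-p⇒p≡0 : ∀ {p} → p ≡ ℚ.- p → p ≡ 0ℚ
p≡-p⇒p≡0 {p} p≡-p = begin
  p                   ≡⟨ solve 1 (λ p → p := con ½ :* (p :+ p)) refl p ⟩
  ½ ℚ.* (p ℚ.+ p)     ≡⟨ cong (λ q → ½ ℚ.* (p ℚ.+ q)) p≡-p ⟩
  ½ ℚ.* (p ℚ.- p)     ≡⟨ solve 1 (λ p → con ½ :* (p :- p) := con 0ℚ) refl p ⟩
  0ℚ ∎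
  where open ≡-Reasoning; open +-*-Solver

p<q⇒p*p<q*q : ∀ {p q} → 0ℚ ℚ.≤ p → p ℚ.< q → p ℚ.* p ℚ.< q ℚ.* q
p<q⇒p*p<q*q {p} {q} 0≤p p<q = ℚₚ.≤-<-trans
  (ℚₚ.*-monoˡ-≤-nonNeg p {{ℚ.nonNegative 0≤p}} (ℚₚ.<⇒≤ p<q))
  (ℚₚ.*-monoˡ-<-pos q {{ℚ.positive (ℚₚ.≤-<-trans 0≤p p<q)}} p<q)

p*p≡q*q⇒p≡q : ∀ {p q} → 0ℚ ℚ.≤ p → 0ℚ ℚ.≤ q → p ℚ.* p ≡ q ℚ.* q → p ≡ q
p*p≡q*q⇒p≡q {p} {q} 0≤p 0≤q p²≡q² with ℚₚ.<-cmp p q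
... | tri≈ _ p≡q _ = p≡q
... | tri< p<q _ _ = ⊥-elim (ℚₚ.<-irrefl p²≡q² (p<q⇒p*p<q*q 0≤p p<q))
... | tri> _ _ q<p = ⊥-elim (ℚₚ.<-irrefl (sym p²≡q²) (p<q⇒p*p<q*q 0≤q q<p))

p*p≡q*q⇒∣p∣≡q : ∀ {p q} → 0ℚ ℚ.≤ q → p ℚ.* p ≡ q ℚ.* q → ℚ.∣ p ∣ ≡ q
p*p≡q*q⇒∣p∣≡q {p} {q} 0≤q p²≡q² = p*p≡q*q⇒p≡q (ℚₚ.0≤∣p∣ p) 0≤q (begin
  ℚ.∣ p ∣ ℚ.* ℚ.∣ p ∣  ≡⟨ ℚₚ.∣p*q∣≡∣p∣*∣q∣ p p ⟨
  ℚ.∣ p ℚ.* p ∣        ≡⟨ cong ℚ.∣_∣ p²≡q² ⟩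
  ℚ.∣ q ℚ.* q ∣        ≡⟨ ℚₚ.∣p*q∣≡∣p∣*∣q∣ q q ⟩
  ℚ.∣ q ∣ ℚ.* ℚ.∣ q ∣  ≡⟨ cong₂ ℚ._*_ ∣q∣≡q ∣q∣≡q ⟩
  q ℚ.* q ∎)
  where
  open ≡-Reasoning
  ∣q∣≡q : ℚ.∣ q ∣ ≡ q
  ∣q∣≡q = ℚₚ.0≤p⇒∣p∣≡p 0≤q

∣h²W∣≡h : ∀ {h M W} → 0ℚ ℚ.≤ h → h ℚ.* M ≡ 1ℚ → W ℚ.* W ≡ M ℚ.* M →
          ℚ.∣ (h ℚ.* h) ℚ.* W ∣ ≡ h
∣h²W∣≡h {h} {M} {W} 0≤h hM≡1 W²≡M² = p*p≡q*q⇒∣p∣≡q 0≤h (begin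
  (h² ℚ.* W) ℚ.* (h² ℚ.* W)         ≡⟨ ℚ-*.interchange h² W h² W ⟩
  (h² ℚ.* h²) ℚ.* (W ℚ.* W)         ≡⟨ cong ((h² ℚ.* h²) ℚ.*_) W²≡M² ⟩
  (h² ℚ.* h²) ℚ.* (M ℚ.* M)         ≡⟨ ℚₚ.*-assoc h² h² (M ℚ.* M) ⟩
  h² ℚ.* (h² ℚ.* (M ℚ.* M))         ≡⟨ cong (h² ℚ.*_) (ℚ-*.interchange h h M M) ⟩
  h² ℚ.* ((h ℚ.* M) ℚ.* (h ℚ.* M))  ≡⟨ cong (λ u → h² ℚ.* (u ℚ.* u)) hM≡1 ⟩
  h² ℚ.* (1ℚ ℚ.* 1ℚ)                ≡⟨ ℚₚ.*-identityʳ h² ⟩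
  h² ∎)
  where
  open ≡-Reasoning
  h² = h ℚ.* h

sum-unique : ∀ {G : (k : ℕ) → (Fin k → ℚ) → ℚ} →
             (∀ g → G 0 g ≡ 0ℚ) → (∀ k g → G (suc k) g ≡ g zero ℚ.+ G k (g ∘ suc)) →
             ∀ k g → G k g ≡ ℚ-Sum.sum g
sum-unique G0 G+ zero g = G0 g
sum-unique {G} G0 G+ (suc k) g = trans (G+ k g) (cong (g zero ℚ.+_) (sum-unique {G} G0 G+ k (g ∘ suc)))

module Field {n : ℕ} (F : GF n) where
  open GF F

  ring : CommutativeRing 0ℓ 0ℓ
  ring = record { isCommutativeRing = isCommutativeRing }

  open CommutativeRing ring public
    using (_-_; +-assoc; +-comm; +-identityˡ; +-identityʳ; -‿inverseˡ; -‿inverseʳ;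
           *-assoc; *-comm; *-identityˡ; *-identityʳ; zeroˡ; zeroʳ; distribˡ; distribʳ)
  open import Algebra.Properties.Ring (CommutativeRing.ring ring) public
    using (+-cancelʳ; +-inverseˡ-unique; x∙y⁻¹≈ε⇒x≈y; [y-z]x≈yx-zx)
  open import Algebra.Solver.Ring.NaturalCoefficients
    (CommutativeRing.commutativeSemiring ring) (λ _ _ → nothing)
    using (solve; _:=_; _:+_; _:*_; _:^_)
  open import Algebra.Properties.CommutativeSemigroup
    (CommutativeMonoid.commutativeSemigroup (CommutativeRing.+-commutativeMonoid ring)) public
    using () renaming (interchange to +-interchange)
  import Algebra.Properties.Semiring.Exp (CommutativeRing.semiring ring) as Exp
  import Algebra.Properties.CommutativeSemiring.Exp (CommutativeRing.commutativeSemiring ring) as CExp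
  import Algebra.Properties.Semiring.Mult (CommutativeRing.semiring ring) as Mult

  1≢0 : 1# ≢ 0#
  1≢0 1≡0 = 0≢1 (sym 1≡0)

  x*y≡0⇒x≡0∨y≡0 : ∀ {x y} → x * y ≡ 0# → x ≡ 0# ⊎ y ≡ 0#
  x*y≡0⇒x≡0∨y≡0 {x} {y} xy≡0 with x ≟ 0#
  ... | yes x≡0 = inj₁ x≡0
  ... | no x≢0 = let (x⁻¹ , xx⁻¹≡1) = inverse x x≢0 in inj₂ (begin
    y               ≡⟨ *-identityˡ y ⟨
    1# * y          ≡⟨ cong (_* y) xx⁻¹≡1 ⟨
    (x * x⁻¹) * y   ≡⟨ solve 3 (λ x x⁻¹ y → (x :* x⁻¹) :* y := x⁻¹ :* (x :* y)) refl x x⁻¹ y ⟩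
    x⁻¹ * (x * y)   ≡⟨ cong (x⁻¹ *_) xy≡0 ⟩
    x⁻¹ * 0#        ≡⟨ zeroʳ x⁻¹ ⟩
    0# ∎)
    where open ≡-Reasoning

  *-≢0 : ∀ {x y} → x ≢ 0# → y ≢ 0# → x * y ≢ 0#
  *-≢0 x≢0 y≢0 xy≡0 = [ x≢0 , y≢0 ] (x*y≡0⇒x≡0∨y≡0 xy≡0)

  ^-≢0 : ∀ {x} k → x ≢ 0# → x ^ k ≢ 0#
  ^-≢0 zero x≢0 = 1≢0
  ^-≢0 (suc k) x≢0 = *-≢0 x≢0 (^-≢0 k x≢0)

  x^k≡0⇒x≡0 : ∀ {x} k → x ^ k ≡ 0# → x ≡ 0#
  x^k≡0⇒x≡0 {x} k x^k≡0 with x ≟ 0#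
  ... | yes x≡0 = x≡0
  ... | no x≢0 = ⊥-elim (^-≢0 k x≢0 x^k≡0)

  *-cancelʳ-≢0 : ∀ {x y} z → z ≢ 0# → x * z ≡ y * z → x ≡ y
  *-cancelʳ-≢0 {x} {y} z z≢0 xz≡yz =
    x∙y⁻¹≈ε⇒x≈y x y ([ id , (λ z≡0 → ⊥-elim (z≢0 z≡0)) ] (x*y≡0⇒x≡0∨y≡0 (begin
      (x - y) * z        ≡⟨ [y-z]x≈yx-zx z x y ⟩
      x * z - y * z      ≡⟨ cong (_- y * z) xz≡yz ⟩
      y * z - y * z      ≡⟨ -‿inverseʳ (y * z) ⟩
      0# ∎)))
    where open ≡-Reasoning

  ^≡Exp^ : ∀ x k → x ^ k ≡ x Exp.^ k
  ^≡Exp^ x zero = refl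
  ^≡Exp^ x (suc k) = cong (x *_) (^≡Exp^ x k)

  ^-homo-* : ∀ x k l → x ^ (k ℕ.+ l) ≡ x ^ k * x ^ l
  ^-homo-* x k l = begin
    x ^ (k ℕ.+ l)            ≡⟨ ^≡Exp^ x (k ℕ.+ l) ⟩
    x Exp.^ (k ℕ.+ l)        ≡⟨ Exp.^-homo-* x k l ⟩
    x Exp.^ k * x Exp.^ l    ≡⟨ cong₂ _*_ (^≡Exp^ x k) (^≡Exp^ x l) ⟨
    x ^ k * x ^ l ∎
    where open ≡-Reasoning

  ^-assocʳ : ∀ x k l → (x ^ k) ^ l ≡ x ^ (k ℕ.* l)
  ^-assocʳ x k l = begin
    (x ^ k) ^ l               ≡⟨ ^≡Exp^ (x ^ k) l ⟩
    (x ^ k) Exp.^ l           ≡⟨ cong (Exp._^ l) (^≡Exp^ x k) ⟩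
    (x Exp.^ k) Exp.^ l       ≡⟨ Exp.^-assocʳ x k l ⟩
    x Exp.^ (k ℕ.* l)         ≡⟨ ^≡Exp^ x (k ℕ.* l) ⟨
    x ^ (k ℕ.* l) ∎
    where open ≡-Reasoning

  ^-distrib-* : ∀ x y k → (x * y) ^ k ≡ x ^ k * y ^ k
  ^-distrib-* x y k = begin
    (x * y) ^ k               ≡⟨ ^≡Exp^ (x * y) k ⟩
    (x * y) Exp.^ k           ≡⟨ CExp.^-distrib-* x y k ⟩
    x Exp.^ k * y Exp.^ k     ≡⟨ cong₂ _*_ (^≡Exp^ x k) (^≡Exp^ y k) ⟨
    x ^ k * y ^ k ∎
    where open ≡-Reasoning

  module FieldSum (M : CommutativeMonoid 0ℓ 0ℓ) where
    open CommutativeMonoid M using (_≈_; _∙_; ε; ∙-congˡ; identityʳ; reflexive)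
      renaming (Carrier to A; trans to ≈-trans)
    open import Algebra.Properties.CommutativeMonoid.Sum M
      using (sum; sum-cong-≗; sum-cong-≋; sum-permute; sum-remove; sum-replicate; sum-replicate-zero; ∑-distrib-+)
      renaming (∑-comm to sum-comm)
    open import Algebra.Definitions.RawMonoid (CommutativeMonoid.rawMonoid M) public using (_×_)

    ∑ : (Carrier → A) → A
    ∑ f = sum (f ∘ Inverse.to enum)

    ∑-cong : ∀ {f g} → (∀ x → f x ≡ g x) → ∑ f ≡ ∑ g
    ∑-cong f≗g = sum-cong-≗ (f≗g ∘ Inverse.to enum)

    ∑-const : ∀ a → ∑ (λ _ → a) ≈ (2 ℕ.^ n) × a
    ∑-const a = sum-replicate (2 ℕ.^ n)

    ∑-distrib : ∀ f g → ∑ (λ x → f x ∙ g x) ≈ ∑ f ∙ ∑ g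
    ∑-distrib f g = ∑-distrib-+ (f ∘ Inverse.to enum) (g ∘ Inverse.to enum)

    ∑-comm : ∀ (f : Carrier → Carrier → A) → ∑ (λ x → ∑ (f x)) ≈ ∑ (λ y → ∑ (λ x → f x y))
    ∑-comm f = sum-comm (λ i j → f (Inverse.to enum i) (Inverse.to enum j))

    ∑-reindex : ∀ (σ : Carrier ↔ Carrier) f → ∑ f ≈ ∑ (f ∘ Inverse.to σ)
    ∑-reindex σ f = ≈-trans (sum-permute (f ∘ Inverse.to enum) (↔-sym enum ↔-∘ (σ ↔-∘ enum)))
      (reflexive (sum-cong-≗ (λ i → cong f (Inverse.strictlyInverseˡ enum (Inverse.to σ (Inverse.to enum i))))))

    sum-supported : ∀ {k} (t : Fin k → A) i → (∀ j → j ≢ i → t j ≈ ε) → sum t ≈ t i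
    sum-supported {suc k} t i t≈ε = begin
      sum t                     ≈⟨ sum-remove t ⟩
      t i ∙ sum (removeAt t i)  ≈⟨ ∙-congˡ (≈-trans (sum-cong-≋ (λ j → t≈ε _ (punchInᵢ≢i i j)))
                                                     (sum-replicate-zero k)) ⟩
      t i ∙ ε                   ≈⟨ identityʳ (t i) ⟩
      t i ∎
      where open ≈-Reasoning (CommutativeMonoid.setoid M)

    ∑-supported-at-0 : ∀ f → (∀ x → x ≢ 0# → f x ≈ ε) → ∑ f ≈ f 0#
    ∑-supported-at-0 f f≈ε = ≈-trans
      (sum-supported (f ∘ Inverse.to enum) (Inverse.from enum 0#)
        (λ i i≢0 → f≈ε _ (λ x≡0 → i≢0 (sym (Inverse.inverseʳ enum (sym x≡0))))))
      (reflexive (cong f (Inverse.strictlyInverseˡ enum 0#)))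

    sum-closed : ∀ (P : A → Set) → P ε → (∀ {a b} → P a → P b → P (a ∙ b)) →
                 ∀ {k} (t : Fin k → A) → (∀ i → P (t i)) → P (sum t)
    sum-closed P Pε P∙ {zero} t Pt = Pε
    sum-closed P Pε P∙ {suc k} t Pt = P∙ (Pt zero) (sum-closed P Pε P∙ (t ∘ suc) (Pt ∘ suc))

    ∑-closed : ∀ (P : A → Set) → P ε → (∀ {a b} → P a → P b → P (a ∙ b)) →
               ∀ f → (∀ x → P (f x)) → P (∑ f)
    ∑-closed P Pε P∙ f Pf = sum-closed P Pε P∙ (f ∘ Inverse.to enum) (Pf ∘ Inverse.to enum)

  +-shift : Carrier → Carrier ↔ Carrier
  +-shift c = mk↔ₛ′ (c +_) (- c +_) (cancel (-‿inverseʳ c)) (cancel (-‿inverseˡ c))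
    where
    cancel : ∀ {a b} → a + b ≡ 0# → ∀ y → a + (b + y) ≡ y
    cancel {a} {b} a+b≡0 y = trans (sym (+-assoc a b y)) (trans (cong (_+ y) a+b≡0) (+-identityˡ y))

  *-scale : ∀ {c} → c ≢ 0# → Carrier ↔ Carrier
  *-scale {c} c≢0 = mk↔ₛ′ (c *_) (c⁻¹ *_) (cancel cc⁻¹≡1) (cancel (trans (*-comm c⁻¹ c) cc⁻¹≡1))
    where
    c⁻¹ = proj₁ (inverse c c≢0)
    cc⁻¹≡1 = proj₂ (inverse c c≢0)
    cancel : ∀ {a b} → a * b ≡ 1# → ∀ y → a * (b * y) ≡ y
    cancel {a} {b} ab≡1 y = trans (sym (*-assoc a b y)) (trans (cong (_* y) ab≡1) (*-identityˡ y))

  module Σ₊ = FieldSum (CommutativeRing.+-commutativeMonoid ring)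
  module Π = FieldSum (CommutativeRing.*-commutativeMonoid ring)
  module Σℚ = FieldSum ℚₚ.+-0-commutativeMonoid

  2^k×1≡[1+1]^k : ∀ k → (2 ℕ.^ k) Σ₊.× 1# ≡ (1# + 1#) ^ k
  2^k×1≡[1+1]^k zero = +-identityʳ 1#
  2^k×1≡[1+1]^k (suc k) = trans (Mult.×1-homo-* 2 (2 ℕ.^ k))
    (cong₂ _*_ (cong (1# +_) (+-identityʳ 1#)) (2^k×1≡[1+1]^k k))

  1+1≡0 : 1# + 1# ≡ 0#
  1+1≡0 = x^k≡0⇒x≡0 n (begin
    (1# + 1#) ^ n                ≡⟨ 2^k×1≡[1+1]^k n ⟨
    (2 ℕ.^ n) Σ₊.× 1#            ≡⟨ Σ₊.∑-const 1# ⟨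
    Σ₊.∑ (λ _ → 1#)              ≡⟨ +-cancelʳ (Σ₊.∑ id) _ _ (begin
        Σ₊.∑ (λ _ → 1#) + Σ₊.∑ id    ≡⟨ Σ₊.∑-distrib (λ _ → 1#) id ⟨
        Σ₊.∑ (1# +_)                 ≡⟨ Σ₊.∑-reindex (+-shift 1#) id ⟨
        Σ₊.∑ id                      ≡⟨ +-identityˡ _ ⟨
        0# + Σ₊.∑ id ∎) ⟩
    0# ∎)
    where open ≡-Reasoning

  x+x≡0 : ∀ x → x + x ≡ 0#
  x+x≡0 x = begin
    x + x               ≡⟨ cong₂ _+_ (*-identityˡ x) (*-identityˡ x) ⟨
    1# * x + 1# * x     ≡⟨ distribʳ x 1# 1# ⟨
    (1# + 1#) * x       ≡⟨ cong (_* x) 1+1≡0 ⟩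
    0# * x              ≡⟨ zeroˡ x ⟩
    0# ∎
    where open ≡-Reasoning

  -x≡x : ∀ x → - x ≡ x
  -x≡x x = sym (+-inverseˡ-unique x x (x+x≡0 x))

  x+[x+y]≡y : ∀ x y → x + (x + y) ≡ y
  x+[x+y]≡y x y = trans (sym (+-assoc x x y)) (trans (cong (_+ y) (x+x≡0 x)) (+-identityˡ y))

  x+y≡0⇒x≡y : ∀ {x y} → x + y ≡ 0# → x ≡ y
  x+y≡0⇒x≡y {x} {y} x+y≡0 = trans (+-inverseˡ-unique x y x+y≡0) (-x≡x y)

  [x+y]^2≡x^2+y^2 : ∀ x y → (x + y) ^ 2 ≡ x ^ 2 + y ^ 2
  [x+y]^2≡x^2+y^2 x y = begin
    (x + y) ^ 2                      ≡⟨ solve 2 (λ x y → (x :+ y) :^ 2 := (x :^ 2 :+ y :^ 2) :+ (x :* y :+ x :* y)) refl x y ⟩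
    (x ^ 2 + y ^ 2) + (x * y + x * y) ≡⟨ cong (x ^ 2 + y ^ 2 +_) (x+x≡0 (x * y)) ⟩
    (x ^ 2 + y ^ 2) + 0#             ≡⟨ +-identityʳ (x ^ 2 + y ^ 2) ⟩
    x ^ 2 + y ^ 2 ∎
    where open ≡-Reasoning

  ^2^k-homo-+ : ∀ k x y → (x + y) ^ (2 ℕ.^ k) ≡ x ^ (2 ℕ.^ k) + y ^ (2 ℕ.^ k)
  ^2^k-homo-+ zero x y = distribʳ 1# x y
  ^2^k-homo-+ (suc k) x y = begin
    (x + y) ^ (2 ℕ.* 2 ℕ.^ k)                ≡⟨ ^-assocʳ (x + y) 2 (2 ℕ.^ k) ⟨
    ((x + y) ^ 2) ^ (2 ℕ.^ k)                ≡⟨ cong (_^ (2 ℕ.^ k)) ([x+y]^2≡x^2+y^2 x y) ⟩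
    (x ^ 2 + y ^ 2) ^ (2 ℕ.^ k)              ≡⟨ ^2^k-homo-+ k (x ^ 2) (y ^ 2) ⟩
    (x ^ 2) ^ (2 ℕ.^ k) + (y ^ 2) ^ (2 ℕ.^ k) ≡⟨ cong₂ _+_ (^-assocʳ x 2 (2 ℕ.^ k)) (^-assocʳ y 2 (2 ℕ.^ k)) ⟩
    x ^ (2 ℕ.* 2 ℕ.^ k) + y ^ (2 ℕ.* 2 ℕ.^ k) ∎
    where open ≡-Reasoning

  0^2^k≡0 : ∀ k → 0# ^ (2 ℕ.^ k) ≡ 0#
  0^2^k≡0 zero = zeroˡ 1#
  0^2^k≡0 (suc k) = trans (^-homo-* 0# (2 ℕ.^ k) (1 ℕ.* 2 ℕ.^ k))
    (trans (cong (_* (0# ^ (1 ℕ.* 2 ℕ.^ k))) (0^2^k≡0 k)) (zeroˡ (0# ^ (1 ℕ.* 2 ℕ.^ k))))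

  ifZero : ∀ {A : Set} → Carrier → A → A → A
  ifZero y a b with y ≟ 0#
  ... | yes _ = a
  ... | no _ = b

  ifZero-≡0 : ∀ {A : Set} {y} {a b : A} → y ≡ 0# → ifZero y a b ≡ a
  ifZero-≡0 {y = y} y≡0 with y ≟ 0#
  ... | yes _ = refl
  ... | no y≢0 = ⊥-elim (y≢0 y≡0)

  ifZero-≢0 : ∀ {A : Set} {y} {a b : A} → y ≢ 0# → ifZero y a b ≡ b
  ifZero-≢0 {y = y} y≢0 with y ≟ 0#
  ... | yes y≡0 = ⊥-elim (y≢0 y≡0)
  ... | no _ = refl

  orOne : Carrier → Carrier
  orOne y = ifZero y 1# y

  orOne-≢0 : ∀ y → orOne y ≢ 0#
  orOne-≢0 y with y ≟ 0#
  ... | yes _ = 1≢0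
  ... | no y≢0 = y≢0

  *-orOne : ∀ {x} → x ≢ 0# → ∀ y → x * orOne y ≡ ifZero y x 1# * orOne (x * y)
  *-orOne {x} x≢0 y with y ≟ 0#
  ... | yes y≡0 = cong (x *_) (sym (ifZero-≡0 (trans (cong (x *_) y≡0) (zeroʳ x))))
  ... | no y≢0 = trans (sym (*-identityˡ (x * y))) (cong (1# *_) (sym (ifZero-≢0 (*-≢0 x≢0 y≢0))))

  -- Multiplying every factor of P = ∏_y orOne y by x permutes the factors with y ≠ 0
  -- and leaves one extra factor x at y = 0.
  fermat-≢0 : ∀ {x} → x ≢ 0# → x ^ (2 ℕ.^ n) ≡ x
  fermat-≢0 {x} x≢0 = *-cancelʳ-≢0 P P≢0 (begin
    x ^ q * P                                    ≡⟨ cong (_* P) (^≡Exp^ x q) ⟩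
    (q Π.× x) * P                                ≡⟨ cong (_* P) (Π.∑-const x) ⟨
    Π.∑ (λ _ → x) * P                            ≡⟨ Π.∑-distrib (λ _ → x) orOne ⟨
    Π.∑ (λ y → x * orOne y)                      ≡⟨ Π.∑-cong (*-orOne x≢0) ⟩
    Π.∑ (λ y → ifZero y x 1# * orOne (x * y))    ≡⟨ Π.∑-distrib (λ y → ifZero y x 1#) (orOne ∘ (x *_)) ⟩
    Π.∑ (λ y → ifZero y x 1#) * Π.∑ (orOne ∘ (x *_))
      ≡⟨ cong₂ _*_ (trans (Π.∑-supported-at-0 _ (λ _ → ifZero-≢0)) (ifZero-≡0 refl))
                   (sym (Π.∑-reindex (*-scale x≢0) orOne)) ⟩
    x * P ∎)
    where
    open ≡-Reasoning
    q = 2 ℕ.^ n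
    P = Π.∑ orOne
    P≢0 : P ≢ 0#
    P≢0 = Π.∑-closed (_≢ 0#) 1≢0 *-≢0 orOne orOne-≢0

  fermat : ∀ x → InSub n x
  fermat x with x ≟ 0#
  ... | yes refl = 0^2^k≡0 n
  ... | no x≢0 = fermat-≢0 x≢0

  InSub-+ : ∀ k {a b} → InSub k a → InSub k b → InSub k (a + b)
  InSub-+ k {a} {b} a∈ b∈ = trans (^2^k-homo-+ k a b) (cong₂ _+_ a∈ b∈)

  InSub-* : ∀ k {a b} → InSub k a → InSub k b → InSub k (a * b)
  InSub-* k {a} {b} a∈ b∈ = trans (^-distrib-* a b (2 ℕ.^ k)) (cong₂ _*_ a∈ b∈)

  InSub-∣ : ∀ {k l z} → k ∣ l → InSub k z → InSub l z
  InSub-∣ {k} {z = z} (divides j refl) z∈ = multiple j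
    where
    multiple : ∀ j → InSub (j ℕ.* k) z
    multiple zero = *-identityʳ z
    multiple (suc j) = begin
      z ^ (2 ℕ.^ (k ℕ.+ j ℕ.* k))          ≡⟨ cong (z ^_) (ℕₚ.^-distribˡ-+-* 2 k (j ℕ.* k)) ⟩
      z ^ (2 ℕ.^ k ℕ.* 2 ℕ.^ (j ℕ.* k))    ≡⟨ ^-assocʳ z (2 ℕ.^ k) (2 ℕ.^ (j ℕ.* k)) ⟨
      (z ^ (2 ℕ.^ k)) ^ (2 ℕ.^ (j ℕ.* k))  ≡⟨ cong (_^ (2 ℕ.^ (j ℕ.* k))) z∈ ⟩
      z ^ (2 ℕ.^ (j ℕ.* k))                ≡⟨ multiple j ⟩
      z ∎
      where open ≡-Reasoning

  InSub-1⇒0∨1 : ∀ {u} → InSub 1 u → u ≡ 0# ⊎ u ≡ 1#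
  InSub-1⇒0∨1 {u} u²≡u = Data.Sum.map₂ x+y≡0⇒x≡y (x*y≡0⇒x≡0∨y≡0 (begin
    u * (u + 1#)         ≡⟨ distribˡ u u 1# ⟩
    u * u + u * 1#       ≡⟨ cong₂ _+_ (trans (cong (u *_) (sym (*-identityʳ u))) u²≡u) (*-identityʳ u) ⟩
    u + u                ≡⟨ x+x≡0 u ⟩
    0# ∎))
    where open ≡-Reasoning

  Tr₁-0 : ∀ ℓ → Tr₁ ℓ 0# ≡ 0#
  Tr₁-0 zero = refl
  Tr₁-0 (suc ℓ) = trans (cong₂ _+_ (Tr₁-0 ℓ) (0^2^k≡0 ℓ)) (+-identityˡ 0#)

  Tr₁-homo-+ : ∀ ℓ x y → Tr₁ ℓ (x + y) ≡ Tr₁ ℓ x + Tr₁ ℓ y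
  Tr₁-homo-+ zero x y = sym (+-identityˡ 0#)
  Tr₁-homo-+ (suc ℓ) x y = trans (cong₂ _+_ (Tr₁-homo-+ ℓ x y) (^2^k-homo-+ ℓ x y))
    (+-interchange (Tr₁ ℓ x) (Tr₁ ℓ y) (x ^ (2 ℕ.^ ℓ)) (y ^ (2 ℕ.^ ℓ)))

  Tr₁-+ : ∀ k ℓ w → Tr₁ (k ℕ.+ ℓ) w ≡ Tr₁ k w + Tr₁ ℓ (w ^ (2 ℕ.^ k))
  Tr₁-+ k zero w rewrite ℕₚ.+-identityʳ k = sym (+-identityʳ (Tr₁ k w))
  Tr₁-+ k (suc ℓ) w rewrite ℕₚ.+-suc k ℓ = begin
    Tr₁ (k ℕ.+ ℓ) w + w ^ (2 ℕ.^ (k ℕ.+ ℓ))        ≡⟨ cong₂ _+_ (Tr₁-+ k ℓ w) w^2^[k+ℓ]≡ ⟩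
    (Tr₁ k w + Tr₁ ℓ w′) + w′ ^ (2 ℕ.^ ℓ)           ≡⟨ +-assoc (Tr₁ k w) (Tr₁ ℓ w′) (w′ ^ (2 ℕ.^ ℓ)) ⟩
    Tr₁ k w + (Tr₁ ℓ w′ + w′ ^ (2 ℕ.^ ℓ)) ∎
    where
    open ≡-Reasoning
    w′ = w ^ (2 ℕ.^ k)
    w^2^[k+ℓ]≡ : w ^ (2 ℕ.^ (k ℕ.+ ℓ)) ≡ w′ ^ (2 ℕ.^ ℓ)
    w^2^[k+ℓ]≡ = trans (cong (w ^_) (ℕₚ.^-distribˡ-+-* 2 k ℓ)) (sym (^-assocʳ w (2 ℕ.^ k) (2 ℕ.^ ℓ)))

  Tr₁-^2^j : ∀ ℓ j w → Tr₁ ℓ w ^ (2 ℕ.^ j) ≡ Tr₁ ℓ (w ^ (2 ℕ.^ j))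
  Tr₁-^2^j zero j w = 0^2^k≡0 j
  Tr₁-^2^j (suc ℓ) j w = trans (^2^k-homo-+ j (Tr₁ ℓ w) (w ^ (2 ℕ.^ ℓ)))
    (cong₂ _+_ (Tr₁-^2^j ℓ j w) (^-comm-exponents (2 ℕ.^ ℓ) (2 ℕ.^ j)))
    where
    ^-comm-exponents : ∀ a b → (w ^ a) ^ b ≡ (w ^ b) ^ a
    ^-comm-exponents a b = trans (^-assocʳ w a b) (trans (cong (w ^_) (ℕₚ.*-comm a b)) (sym (^-assocʳ w b a)))

  Tr₁-InSub : ∀ ℓ {w} → InSub ℓ w → InSub 1 (Tr₁ ℓ w)
  Tr₁-InSub ℓ {w} w∈ = trans (Tr₁-^2^j ℓ 1 w) (sym (+-cancelʳ w _ _ (begin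
    Tr₁ ℓ w + w                        ≡⟨ cong (Tr₁ ℓ w +_) w∈ ⟨
    Tr₁ (1 ℕ.+ ℓ) w                    ≡⟨ Tr₁-+ 1 ℓ w ⟩
    (0# + w ^ 1) + Tr₁ ℓ (w ^ 2)       ≡⟨ cong (_+ Tr₁ ℓ (w ^ 2)) (trans (+-identityˡ (w ^ 1)) (*-identityʳ w)) ⟩
    w + Tr₁ ℓ (w ^ 2)                  ≡⟨ +-comm w (Tr₁ ℓ (w ^ 2)) ⟩
    Tr₁ ℓ (w ^ 2) + w ∎)))
    where open ≡-Reasoning

  module Polynomial where
    open import Data.Product using (_×_)

    -- Poly d c f : f is a polynomial function of degree ≤ d whose x^d-coefficient is c.
    data Poly : ℕ → Carrier → (Carrier → Carrier) → Set where
      const  : ∀ {c f} → (∀ x → f x ≡ c) → Poly 0 c f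
      horner : ∀ {d c f} g a → Poly d c g → (∀ x → f x ≡ x * g x + a) → Poly (suc d) c f

    Poly-zero : ∀ d → Poly d 0# (λ _ → 0#)
    Poly-zero zero = const (λ _ → refl)
    Poly-zero (suc d) = horner _ 0# (Poly-zero d) (λ x → sym (trans (cong (_+ 0#) (zeroʳ x)) (+-identityʳ 0#)))

    Poly-raise : ∀ {d e c f} → Poly d c f → d ℕ.< e → Poly e 0# f
    Poly-raise {e = suc e} {c} (const f≡c) (ℕ.s≤s _) =
      horner _ c (Poly-zero e) (λ x → trans (f≡c x) (sym (trans (cong (_+ c) (zeroʳ x)) (+-identityˡ c))))
    Poly-raise (horner g a p f≡) (ℕ.s≤s d<e) = horner g a (Poly-raise p d<e) f≡

    Poly-+ : ∀ {d c c′ f g} → Poly d c f → Poly d c′ g → Poly d (c + c′) (λ x → f x + g x)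
    Poly-+ (const f≡c) (const g≡c′) = const (λ x → cong₂ _+_ (f≡c x) (g≡c′ x))
    Poly-+ (horner f′ a p f≡) (horner g′ b q g≡) = horner _ (a + b) (Poly-+ p q) (λ x →
      trans (cong₂ _+_ (f≡ x) (g≡ x))
        (solve 5 (λ x u v a b → (x :* u :+ a) :+ (x :* v :+ b) := x :* (u :+ v) :+ (a :+ b))
                 refl x (f′ x) (g′ x) a b))

    Poly-^ : ∀ k → Poly k 1# (_^ k)
    Poly-^ zero = const (λ _ → refl)
    Poly-^ (suc k) = horner _ 0# (Poly-^ k) (λ x → sym (+-identityʳ _))

    factor : ∀ {d c f} → Poly (suc d) c f → ∀ α → ∃ λ g → Poly d c g × (∀ x → f x ≡ (x + α) * g x + f α)
    factor {zero} {c} {f} (horner g a (const g≡c) f≡) α = (λ _ → c) , const (λ _ → refl) , λ x → begin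
      f x                               ≡⟨ f≡ x ⟩
      x * g x + a                       ≡⟨ cong (λ u → x * u + a) (g≡c x) ⟩
      x * c + a                         ≡⟨ +-identityʳ _ ⟨
      (x * c + a) + 0#                  ≡⟨ cong ((x * c + a) +_) (trans (cong (_* c) (x+x≡0 α)) (zeroˡ c)) ⟨
      (x * c + a) + (α + α) * c
        ≡⟨ solve 4 (λ x c a α → (x :* c :+ a) :+ (α :+ α) :* c := (x :+ α) :* c :+ (α :* c :+ a)) refl x c a α ⟩
      (x + α) * c + (α * c + a)         ≡⟨ cong (λ u → (x + α) * c + (α * u + a)) (g≡c α) ⟨
      (x + α) * c + (α * g α + a)       ≡⟨ cong ((x + α) * c +_) (f≡ α) ⟨
      (x + α) * c + f α ∎
      where open ≡-Reasoning
    factor {suc d} {c} {f} (horner g a p f≡) α with factor p α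
    ... | h , q , g≡ = (λ x → x * h x + g α) , horner h (g α) q (λ _ → refl) , λ x → begin
      f x                                          ≡⟨ f≡ x ⟩
      x * g x + a                                  ≡⟨ cong (λ u → x * u + a) (g≡ x) ⟩
      x * ((x + α) * h x + g α) + a                ≡⟨ +-identityʳ _ ⟨
      (x * ((x + α) * h x + g α) + a) + 0#         ≡⟨ cong (_ +_) (trans (cong (_* g α) (x+x≡0 α)) (zeroˡ (g α))) ⟨
      (x * ((x + α) * h x + g α) + a) + (α + α) * g α
        ≡⟨ solve 5 (λ x α h g a → (x :* ((x :+ α) :* h :+ g) :+ a) :+ (α :+ α) :* g
                               := (x :+ α) :* (x :* h :+ g) :+ (α :* g :+ a)) refl x α (h x) (g α) a ⟩
      (x + α) * (x * h x + g α) + (α * g α + a)    ≡⟨ cong ((x + α) * (x * h x + g α) +_) (f≡ α) ⟨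
      (x + α) * (x * h x + g α) + f α ∎
      where open ≡-Reasoning

    roots-bound : ∀ {d f xs} → Poly d 1# f → Unique xs → All (λ x → f x ≡ 0#) xs → length xs ℕ.≤ d
    roots-bound {xs = []} _ _ _ = ℕ.z≤n
    roots-bound {xs = x ∷ _} (const f≡1) _ (fx≡0 ∷ _) = ⊥-elim (1≢0 (trans (sym (f≡1 x)) fx≡0))
    roots-bound {f = f} {xs = α ∷ xs} p@(horner _ _ _ _) (α∉xs ∷ xs!) (fα≡0 ∷ fxs≡0) with factor p α
    ... | g , q , f≡ = ℕ.s≤s (roots-bound q xs! (All.zipWith root-of-g (α∉xs , fxs≡0)))
      where
      root-of-g : ∀ {y} → α ≢ y × f y ≡ 0# → g y ≡ 0#
      root-of-g {y} (α≢y , fy≡0) = [ (λ y+α≡0 → ⊥-elim (α≢y (sym (x+y≡0⇒x≡y y+α≡0)))) , id ]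
        (x*y≡0⇒x≡0∨y≡0 (begin
          (y + α) * g y            ≡⟨ +-identityʳ _ ⟨
          (y + α) * g y + 0#       ≡⟨ cong (_ +_) fα≡0 ⟨
          (y + α) * g y + f α      ≡⟨ f≡ y ⟨
          f y                      ≡⟨ fy≡0 ⟩
          0# ∎))
        where open ≡-Reasoning

    Tr₁-degree : ∀ ℓ → Poly (2 ℕ.^ ℓ) 0# (Tr₁ ℓ)
    Tr₁-monic : ∀ ℓ → Poly (2 ℕ.^ ℓ) 1# (Tr₁ (suc ℓ))

    Tr₁-degree zero = Poly-raise (const (λ _ → refl)) (ℕₚ.n<1+n 0)
    Tr₁-degree (suc ℓ) = Poly-raise (Tr₁-monic ℓ) (ℕₚ.^-monoʳ-< 2 (ℕₚ.n<1+n 1) (ℕₚ.n<1+n ℓ))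
    Tr₁-monic ℓ = subst (λ c → Poly (2 ℕ.^ ℓ) c (Tr₁ (suc ℓ))) (+-identityˡ 1#)
      (Poly-+ (Tr₁-degree ℓ) (Poly-^ (2 ℕ.^ ℓ)))

    elements : List Carrier
    elements = tabulate (Inverse.to enum)

    monic-nonvanishing : ∀ {d f} → Poly d 1# f → d ℕ.< 2 ℕ.^ n → ∃ λ x → f x ≢ 0#
    monic-nonvanishing {d} {f} p d<q with All.all? (λ x → f x ≟ 0#) elements
    ... | no ¬all = Any.satisfied (¬All⇒Any¬ (λ x → f x ≟ 0#) elements ¬all)
    ... | yes all = ⊥-elim (ℕₚ.<⇒≱ d<q (begin
      2 ℕ.^ n          ≡⟨ Data.List.Properties.length-tabulate (Inverse.to enum) ⟨
      length elements  ≤⟨ roots-bound p (Unique.tabulate⁺ (Injection.injective (↔⇒↣ enum))) all ⟩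
      d ∎))
      where open ℕₚ.≤-Reasoning

  degree≢0 : n ≢ 0
  degree≢0 n≡0 = 0≢1 (Injection.injective (↔⇒↣ (↔-sym enum)) (Fin-2^0-trivial _ _))
    where
    Fin-2^0-trivial : (i j : Fin (2 ℕ.^ n)) → i ≡ j
    Fin-2^0-trivial = subst (λ k → (i j : Fin (2 ℕ.^ k)) → i ≡ j) (sym n≡0) (λ { zero zero → refl })

  Tr₁-surjective : ∃ λ x → Tr₁ n x ≡ 1#
  Tr₁-surjective =
    let (x , Tr₁x≢0) = monic-nonvanishing Tr₁-monic′ (ℕₚ.^-monoʳ-< 2 (ℕₚ.n<1+n 1) pred[n]<n)
    in x , [ (λ Tr₁x≡0 → ⊥-elim (Tr₁x≢0 Tr₁x≡0)) , id ]′ (InSub-1⇒0∨1 (Tr₁-InSub n (fermat x)))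
    where
    open Polynomial
    suc-pred : suc (ℕ.pred n) ≡ n
    suc-pred = ℕₚ.suc-pred n {{ℕ.≢-nonZero degree≢0}}
    pred[n]<n : ℕ.pred n ℕ.< n
    pred[n]<n = subst (ℕ.pred n ℕ.<_) suc-pred (ℕₚ.n<1+n (ℕ.pred n))
    Tr₁-monic′ : Poly (2 ℕ.^ ℕ.pred n) 1# (Tr₁ n)
    Tr₁-monic′ = subst (λ k → Poly (2 ℕ.^ ℕ.pred n) 1# (Tr₁ k)) suc-pred (Tr₁-monic (ℕ.pred n))

  sign-0 : sign 0# ≡ 1ℚ
  sign-0 with 0# ≟ 0#
  ... | yes _ = refl
  ... | no 0≢0 = ⊥-elim (0≢0 refl)

  sign-1 : sign 1# ≡ ℚ.- 1ℚ
  sign-1 with 1# ≟ 0#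
  ... | yes 1≡0 = ⊥-elim (1≢0 1≡0)
  ... | no _ = refl

  sign-homo-+ : ∀ {u v} → InSub 1 u → InSub 1 v → sign (u + v) ≡ sign u ℚ.* sign v
  sign-homo-+ u∈ v∈ with InSub-1⇒0∨1 u∈ | InSub-1⇒0∨1 v∈
  ... | inj₁ refl | inj₁ refl = trans (cong sign (+-identityˡ 0#)) (trans sign-0 (sym (cong₂ ℚ._*_ sign-0 sign-0)))
  ... | inj₁ refl | inj₂ refl = trans (cong sign (+-identityˡ 1#)) (trans sign-1 (sym (cong₂ ℚ._*_ sign-0 sign-1)))
  ... | inj₂ refl | inj₁ refl = trans (cong sign (+-identityʳ 1#)) (trans sign-1 (sym (cong₂ ℚ._*_ sign-1 sign-0)))
  ... | inj₂ refl | inj₂ refl = trans (cong sign 1+1≡0) (trans sign-0 (sym (cong₂ ℚ._*_ sign-1 sign-1)))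

  χ : Carrier → ℚ
  χ w = sign (Tr₁ n w)

  χ-homo-+ : ∀ u v → χ (u + v) ≡ χ u ℚ.* χ v
  χ-homo-+ u v = trans (cong sign (Tr₁-homo-+ n u v))
    (sign-homo-+ (Tr₁-InSub n (fermat u)) (Tr₁-InSub n (fermat v)))

  Σℚ-*-distribˡ : ∀ c f → Σℚ.∑ (λ x → c ℚ.* f x) ≡ c ℚ.* Σℚ.∑ f
  Σℚ-*-distribˡ c f = sym (ℚ-Sum.*-distribˡ-sum c (f ∘ Inverse.to enum))

  Σℚ-*-distribʳ : ∀ c f → Σℚ.∑ f ℚ.* c ≡ Σℚ.∑ (λ x → f x ℚ.* c)
  Σℚ-*-distribʳ c f = ℚ-Sum.*-distribʳ-sum c (f ∘ Inverse.to enum)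

  ∑χ≡0 : Σℚ.∑ χ ≡ 0ℚ
  ∑χ≡0 = p≡-p⇒p≡0 (begin
    Σℚ.∑ χ                         ≡⟨ Σℚ.∑-reindex (+-shift x₀) χ ⟩
    Σℚ.∑ (λ x → χ (x₀ + x))        ≡⟨ Σℚ.∑-cong (χ-homo-+ x₀) ⟩
    Σℚ.∑ (λ x → χ x₀ ℚ.* χ x)      ≡⟨ Σℚ-*-distribˡ (χ x₀) χ ⟩
    χ x₀ ℚ.* Σℚ.∑ χ                ≡⟨ cong (λ e → sign e ℚ.* Σℚ.∑ χ) Tr₁x₀≡1 ⟩
    sign 1# ℚ.* Σℚ.∑ χ             ≡⟨ cong (ℚ._* Σℚ.∑ χ) sign-1 ⟩
    ℚ.- 1ℚ ℚ.* Σℚ.∑ χ              ≡⟨ ℚₚ.neg-distribˡ-* 1ℚ (Σℚ.∑ χ) ⟨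
    ℚ.- (1ℚ ℚ.* Σℚ.∑ χ)            ≡⟨ cong ℚ.-_ (ℚₚ.*-identityˡ (Σℚ.∑ χ)) ⟩
    ℚ.- Σℚ.∑ χ ∎)
    where
    open ≡-Reasoning
    x₀ = proj₁ Tr₁-surjective
    Tr₁x₀≡1 = proj₂ Tr₁-surjective

  ∑χ[c*x]≡0 : ∀ {c} → c ≢ 0# → Σℚ.∑ (λ x → χ (c * x)) ≡ 0ℚ
  ∑χ[c*x]≡0 c≢0 = trans (sym (Σℚ.∑-reindex (*-scale c≢0) χ)) ∑χ≡0

  -- Defs.Σ recurses through a local function that cannot be named; once its arguments are
  -- abstracted, unification supplies it as the G of sum-unique.
  Σ≡∑ : ∀ f → Σ f ≡ Σℚ.∑ f
  Σ≡∑ f with 2 ℕ.^ n | f ∘ Inverse.to enum | sum-unique {G = _} (λ _ → refl) (λ _ _ → refl)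
  ... | k | g | G≡sum = G≡sum k g

module QuadraticForm {m : ℕ} (F : GF (2 ℕ.* m)) where
  open GF F
  open Field F
  open Σℚ using (∑; ∑-cong; ∑-reindex; ∑-comm; ∑-supported-at-0; ∑-const)
  open import Algebra.Solver.Ring.NaturalCoefficients
    (CommutativeRing.commutativeSemiring ring) (λ _ _ → nothing)
    using (solve; _:=_; _:+_; _:*_)

  φ : Carrier → Carrier → Carrier → Carrier
  φ a b x = Tr₁ m (a * x ^ (2 ℕ.^ m ℕ.+ 1)) + Tr₁ (2 ℕ.* m) (b * x)

  x^[2^m+1]≡x^2^m*x : ∀ x → x ^ (2 ℕ.^ m ℕ.+ 1) ≡ x ^ (2 ℕ.^ m) * x
  x^[2^m+1]≡x^2^m*x x = trans (^-homo-* x (2 ℕ.^ m) 1) (cong (x ^ (2 ℕ.^ m) *_) (*-identityʳ x))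

  2^[2*m]≡2^m*2^m : 2 ℕ.^ (2 ℕ.* m) ≡ 2 ℕ.^ m ℕ.* 2 ℕ.^ m
  2^[2*m]≡2^m*2^m = trans (cong (λ k → 2 ℕ.^ (m ℕ.+ k)) (ℕₚ.+-identityʳ m)) (ℕₚ.^-distribˡ-+-* 2 m m)

  [x^2^m]^2^m≡x : ∀ x → (x ^ (2 ℕ.^ m)) ^ (2 ℕ.^ m) ≡ x
  [x^2^m]^2^m≡x x = begin
    (x ^ (2 ℕ.^ m)) ^ (2 ℕ.^ m)   ≡⟨ ^-assocʳ x (2 ℕ.^ m) (2 ℕ.^ m) ⟩
    x ^ (2 ℕ.^ m ℕ.* 2 ℕ.^ m)     ≡⟨ cong (x ^_) 2^[2*m]≡2^m*2^m ⟨
    x ^ (2 ℕ.^ (2 ℕ.* m))         ≡⟨ fermat x ⟩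
    x ∎
    where open ≡-Reasoning

  norm-InSub : ∀ x → InSub m (x ^ (2 ℕ.^ m ℕ.+ 1))
  norm-InSub x = begin
    (x ^ (2 ℕ.^ m ℕ.+ 1)) ^ (2 ℕ.^ m)      ≡⟨ cong (_^ (2 ℕ.^ m)) (x^[2^m+1]≡x^2^m*x x) ⟩
    (X * x) ^ (2 ℕ.^ m)                    ≡⟨ ^-distrib-* X x (2 ℕ.^ m) ⟩
    X ^ (2 ℕ.^ m) * X                      ≡⟨ cong (_* X) ([x^2^m]^2^m≡x x) ⟩
    x * X                                  ≡⟨ *-comm x X ⟩
    X * x                                  ≡⟨ x^[2^m+1]≡x^2^m*x x ⟨
    x ^ (2 ℕ.^ m ℕ.+ 1) ∎
    where
    open ≡-Reasoning
    X = x ^ (2 ℕ.^ m)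

  φ-InSub : ∀ {a} b x → InSub m a → InSub 1 (φ a b x)
  φ-InSub b x a∈ =
    InSub-+ 1 (Tr₁-InSub m (InSub-* m a∈ (norm-InSub x))) (Tr₁-InSub (2 ℕ.* m) (fermat (b * x)))

  φ-homo-+ : ∀ a₁ a₂ b₁ b₂ x → φ (a₁ + a₂) (b₁ + b₂) x ≡ φ a₁ b₁ x + φ a₂ b₂ x
  φ-homo-+ a₁ a₂ b₁ b₂ x = begin
    Tr₁ m ((a₁ + a₂) * N) + Tr₁ (2 ℕ.* m) ((b₁ + b₂) * x)
      ≡⟨ cong₂ _+_ (trans (cong (Tr₁ m) (distribʳ N a₁ a₂)) (Tr₁-homo-+ m _ _))
                   (trans (cong (Tr₁ (2 ℕ.* m)) (distribʳ x b₁ b₂)) (Tr₁-homo-+ (2 ℕ.* m) _ _)) ⟩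
    (Tr₁ m (a₁ * N) + Tr₁ m (a₂ * N)) + (Tr₁ (2 ℕ.* m) (b₁ * x) + Tr₁ (2 ℕ.* m) (b₂ * x))
      ≡⟨ +-interchange _ _ _ _ ⟩
    φ a₁ b₁ x + φ a₂ b₂ x ∎
    where
    open ≡-Reasoning
    N = x ^ (2 ℕ.^ m ℕ.+ 1)

  Tr₁-2m : ∀ w → Tr₁ (2 ℕ.* m) w ≡ Tr₁ m w + Tr₁ m (w ^ (2 ℕ.^ m))
  Tr₁-2m w = trans (Tr₁-+ m (m ℕ.+ 0) w) (cong (λ k → Tr₁ m w + Tr₁ k (w ^ (2 ℕ.^ m))) (ℕₚ.+-identityʳ m))

  norm-polarisation : ∀ {a} x z → InSub m a → let w = a * z ^ (2 ℕ.^ m) * x in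
    a * (x + z) ^ (2 ℕ.^ m ℕ.+ 1) ≡ (a * x ^ (2 ℕ.^ m ℕ.+ 1) + a * z ^ (2 ℕ.^ m ℕ.+ 1)) + (w + w ^ (2 ℕ.^ m))
  norm-polarisation {a} x z a∈ = begin
    a * (x + z) ^ (2 ℕ.^ m ℕ.+ 1)
      ≡⟨ cong (a *_) (trans (x^[2^m+1]≡x^2^m*x (x + z)) (cong (_* (x + z)) (^2^k-homo-+ m x z))) ⟩
    a * ((X + Z) * (x + z))
      ≡⟨ solve 5 (λ a X Z x z → a :* ((X :+ Z) :* (x :+ z))
                             := (a :* (X :* x) :+ a :* (Z :* z)) :+ (a :* Z :* x :+ a :* z :* X)) refl a X Z x z ⟩
    (a * (X * x) + a * (Z * z)) + (a * Z * x + a * z * X)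
      ≡⟨ cong₂ _+_ (cong₂ _+_ (cong (a *_) (sym (x^[2^m+1]≡x^2^m*x x))) (cong (a *_) (sym (x^[2^m+1]≡x^2^m*x z))))
                   (cong (a * Z * x +_) (sym w^2^m≡azX)) ⟩
    (a * x ^ (2 ℕ.^ m ℕ.+ 1) + a * z ^ (2 ℕ.^ m ℕ.+ 1)) + (a * Z * x + (a * Z * x) ^ (2 ℕ.^ m)) ∎
    where
    open ≡-Reasoning
    X = x ^ (2 ℕ.^ m)
    Z = z ^ (2 ℕ.^ m)
    w^2^m≡azX : (a * Z * x) ^ (2 ℕ.^ m) ≡ a * z * X
    w^2^m≡azX = begin
      (a * Z * x) ^ (2 ℕ.^ m)            ≡⟨ ^-distrib-* (a * Z) x (2 ℕ.^ m) ⟩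
      (a * Z) ^ (2 ℕ.^ m) * X            ≡⟨ cong (_* X) (^-distrib-* a Z (2 ℕ.^ m)) ⟩
      a ^ (2 ℕ.^ m) * Z ^ (2 ℕ.^ m) * X  ≡⟨ cong₂ (λ u v → u * v * X) a∈ ([x^2^m]^2^m≡x z) ⟩
      a * z * X ∎

  φ-polarisation : ∀ {a} b x z → InSub m a →
    φ a b (x + z) ≡ (φ a b x + φ a b z) + Tr₁ (2 ℕ.* m) (a * z ^ (2 ℕ.^ m) * x)
  φ-polarisation {a} b x z a∈ = begin
    Tr₁ m (a * (x + z) ^ (2 ℕ.^ m ℕ.+ 1)) + Tr₁ (2 ℕ.* m) (b * (x + z))
      ≡⟨ cong₂ _+_ Tr₁-quadratic (trans (cong (Tr₁ (2 ℕ.* m)) (distribˡ b x z)) (Tr₁-homo-+ (2 ℕ.* m) _ _)) ⟩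
    ((Qx + Qz) + T) + (Lx + Lz)
      ≡⟨ solve 5 (λ Qx Qz T Lx Lz → ((Qx :+ Qz) :+ T) :+ (Lx :+ Lz) := ((Qx :+ Lx) :+ (Qz :+ Lz)) :+ T)
                 refl Qx Qz T Lx Lz ⟩
    ((Qx + Lx) + (Qz + Lz)) + T ∎
    where
    open ≡-Reasoning
    w = a * z ^ (2 ℕ.^ m) * x
    Qx = Tr₁ m (a * x ^ (2 ℕ.^ m ℕ.+ 1))
    Qz = Tr₁ m (a * z ^ (2 ℕ.^ m ℕ.+ 1))
    T = Tr₁ (2 ℕ.* m) w
    Lx = Tr₁ (2 ℕ.* m) (b * x)
    Lz = Tr₁ (2 ℕ.* m) (b * z)
    Tr₁-quadratic : Tr₁ m (a * (x + z) ^ (2 ℕ.^ m ℕ.+ 1)) ≡ (Qx + Qz) + T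
    Tr₁-quadratic = begin
      Tr₁ m (a * (x + z) ^ (2 ℕ.^ m ℕ.+ 1))
        ≡⟨ cong (Tr₁ m) (norm-polarisation x z a∈) ⟩
      Tr₁ m ((a * x ^ (2 ℕ.^ m ℕ.+ 1) + a * z ^ (2 ℕ.^ m ℕ.+ 1)) + (w + w ^ (2 ℕ.^ m)))
        ≡⟨ Tr₁-homo-+ m _ _ ⟩
      Tr₁ m (a * x ^ (2 ℕ.^ m ℕ.+ 1) + a * z ^ (2 ℕ.^ m ℕ.+ 1)) + Tr₁ m (w + w ^ (2 ℕ.^ m))
        ≡⟨ cong₂ _+_ (Tr₁-homo-+ m _ _) (trans (Tr₁-homo-+ m _ _) (sym (Tr₁-2m w))) ⟩
      (Qx + Qz) + T ∎

  φ-0 : ∀ a b → φ a b 0# ≡ 0#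
  φ-0 a b = begin
    Tr₁ m (a * 0# ^ (2 ℕ.^ m ℕ.+ 1)) + Tr₁ (2 ℕ.* m) (b * 0#)
      ≡⟨ cong₂ (λ u v → Tr₁ m (a * u) + Tr₁ (2 ℕ.* m) v) (trans (x^[2^m+1]≡x^2^m*x 0#) (zeroʳ _)) (zeroʳ b) ⟩
    Tr₁ m (a * 0#) + Tr₁ (2 ℕ.* m) 0#
      ≡⟨ cong₂ _+_ (trans (cong (Tr₁ m) (zeroʳ a)) (Tr₁-0 m)) (Tr₁-0 (2 ℕ.* m)) ⟩
    0# + 0#
      ≡⟨ +-identityʳ 0# ⟩
    0# ∎
    where open ≡-Reasoning

  W : Carrier → Carrier → ℚ
  W a b = ∑ (λ x → sign (φ a b x))

  W*W≡∑1 : ∀ {a} b → InSub m a → a ≢ 0# → W a b ℚ.* W a b ≡ ∑ (λ _ → 1ℚ)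
  W*W≡∑1 {a} b a∈ a≢0 = begin
    W a b ℚ.* W a b                             ≡⟨ Σℚ-*-distribʳ (W a b) s ⟩
    ∑ (λ x → s x ℚ.* W a b)                     ≡⟨ ∑-cong (λ x → Σℚ-*-distribˡ (s x) s) ⟨
    ∑ (λ x → ∑ (λ y → s x ℚ.* s y))             ≡⟨ ∑-cong (λ x → ∑-reindex (+-shift x) (λ y → s x ℚ.* s y)) ⟩
    ∑ (λ x → ∑ (λ z → s x ℚ.* s (x + z)))       ≡⟨ ∑-cong (λ x → ∑-cong (s*s-shift x)) ⟩
    ∑ (λ x → ∑ (λ z → s z ℚ.* χ (c z * x)))     ≡⟨ ∑-comm (λ x z → s z ℚ.* χ (c z * x)) ⟩
    ∑ (λ z → ∑ (λ x → s z ℚ.* χ (c z * x)))     ≡⟨ ∑-cong (λ z → Σℚ-*-distribˡ (s z) (χ ∘ (c z *_))) ⟩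
    ∑ (λ z → s z ℚ.* ∑ (χ ∘ (c z *_)))          ≡⟨ ∑-supported-at-0 _ only-z≡0 ⟩
    s 0# ℚ.* ∑ (χ ∘ (c 0# *_))                  ≡⟨ cong₂ ℚ._*_ (trans (cong sign (φ-0 a b)) sign-0) (∑-cong χ[c0*x]≡1) ⟩
    1ℚ ℚ.* ∑ (λ _ → 1ℚ)                         ≡⟨ ℚₚ.*-identityˡ _ ⟩
    ∑ (λ _ → 1ℚ) ∎
    where
    open ≡-Reasoning
    s : Carrier → ℚ
    s x = sign (φ a b x)
    c : Carrier → Carrier
    c z = a * z ^ (2 ℕ.^ m)

    s*s-shift : ∀ x z → s x ℚ.* s (x + z) ≡ s z ℚ.* χ (c z * x)
    s*s-shift x z = begin
      s x ℚ.* s (x + z)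
        ≡⟨ sign-homo-+ (φ-InSub b x a∈) (φ-InSub b (x + z) a∈) ⟨
      sign (φ a b x + φ a b (x + z))
        ≡⟨ cong (λ u → sign (φ a b x + u)) (trans (φ-polarisation b x z a∈) (+-assoc _ _ _)) ⟩
      sign (φ a b x + (φ a b x + (φ a b z + Tr₁ (2 ℕ.* m) (c z * x))))
        ≡⟨ cong sign (x+[x+y]≡y _ _) ⟩
      sign (φ a b z + Tr₁ (2 ℕ.* m) (c z * x))
        ≡⟨ sign-homo-+ (φ-InSub b z a∈) (Tr₁-InSub (2 ℕ.* m) (fermat _)) ⟩
      s z ℚ.* χ (c z * x) ∎

    only-z≡0 : ∀ z → z ≢ 0# → s z ℚ.* ∑ (χ ∘ (c z *_)) ≡ 0ℚ
    only-z≡0 z z≢0 = trans (cong (s z ℚ.*_) (∑χ[c*x]≡0 (*-≢0 a≢0 (^-≢0 (2 ℕ.^ m) z≢0)))) (ℚₚ.*-zeroʳ (s z))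

    χ[c0*x]≡1 : ∀ x → χ (c 0# * x) ≡ 1ℚ
    χ[c0*x]≡1 x = begin
      sign (Tr₁ (2 ℕ.* m) (a * 0# ^ (2 ℕ.^ m) * x))
        ≡⟨ cong (λ u → sign (Tr₁ (2 ℕ.* m) (a * u * x))) (0^2^k≡0 m) ⟩
      sign (Tr₁ (2 ℕ.* m) (a * 0# * x))
        ≡⟨ cong (λ u → sign (Tr₁ (2 ℕ.* m) (u * x))) (zeroʳ a) ⟩
      sign (Tr₁ (2 ℕ.* m) (0# * x))
        ≡⟨ cong (λ u → sign (Tr₁ (2 ℕ.* m) u)) (zeroˡ x) ⟩
      sign (Tr₁ (2 ℕ.* m) 0#)
        ≡⟨ cong sign (Tr₁-0 (2 ℕ.* m)) ⟩
      sign 0#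
        ≡⟨ sign-0 ⟩
      1ℚ ∎

  ⟪B,B⟫≡½^m*½^m*W : ∀ a₁ a₂ b₁ b₂ → InSub m a₁ → InSub m a₂ →
                    ⟪ B F m a₁ b₁ , B F m a₂ b₂ ⟫ ≡ (½^ m ℚ.* ½^ m) ℚ.* W (a₁ + a₂) (b₁ + b₂)
  ⟪B,B⟫≡½^m*½^m*W a₁ a₂ b₁ b₂ a₁∈ a₂∈ = begin
    Σ (λ x → B₁ x ℚ.* B₂ x)                                ≡⟨ Σ≡∑ (λ x → B₁ x ℚ.* B₂ x) ⟩
    ∑ (λ x → B₁ x ℚ.* B₂ x)                                ≡⟨ ∑-cong B₁*B₂≡ ⟩
    ∑ (λ x → (½^ m ℚ.* ½^ m) ℚ.* sign (φ a b x))           ≡⟨ Σℚ-*-distribˡ (½^ m ℚ.* ½^ m) (λ x → sign (φ a b x)) ⟩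
    (½^ m ℚ.* ½^ m) ℚ.* W (a₁ + a₂) (b₁ + b₂) ∎
    where
    open ≡-Reasoning
    B₁ = B F m a₁ b₁
    B₂ = B F m a₂ b₂
    a = a₁ + a₂
    b = b₁ + b₂
    B₁*B₂≡ : ∀ x → B₁ x ℚ.* B₂ x ≡ (½^ m ℚ.* ½^ m) ℚ.* sign (φ a b x)
    B₁*B₂≡ x = begin
      (½^ m ℚ.* sign (φ a₁ b₁ x)) ℚ.* (½^ m ℚ.* sign (φ a₂ b₂ x))
        ≡⟨ ℚ-*.interchange (½^ m) (sign (φ a₁ b₁ x)) (½^ m) (sign (φ a₂ b₂ x)) ⟩
      (½^ m ℚ.* ½^ m) ℚ.* (sign (φ a₁ b₁ x) ℚ.* sign (φ a₂ b₂ x))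
        ≡⟨ cong ((½^ m ℚ.* ½^ m) ℚ.*_) (sign-homo-+ (φ-InSub b₁ x a₁∈) (φ-InSub b₂ x a₂∈)) ⟨
      (½^ m ℚ.* ½^ m) ℚ.* sign (φ a₁ b₁ x + φ a₂ b₂ x)
        ≡⟨ cong (λ u → (½^ m ℚ.* ½^ m) ℚ.* sign u) (φ-homo-+ a₁ a₂ b₁ b₂ x) ⟨
      (½^ m ℚ.* ½^ m) ℚ.* sign (φ a b x) ∎

  ∑1≡2^m*2^m : ∑ (λ _ → 1ℚ) ≡ ((2 ℕ.^ m) ℚ-Mult.× 1ℚ) ℚ.* ((2 ℕ.^ m) ℚ-Mult.× 1ℚ)
  ∑1≡2^m*2^m = begin
    ∑ (λ _ → 1ℚ)                              ≡⟨ ∑-const 1ℚ ⟩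
    (2 ℕ.^ (2 ℕ.* m)) ℚ-Mult.× 1ℚ             ≡⟨ cong (ℚ-Mult._× 1ℚ) 2^[2*m]≡2^m*2^m ⟩
    (2 ℕ.^ m ℕ.* 2 ℕ.^ m) ℚ-Mult.× 1ℚ         ≡⟨ ℚ-Mult.×1-homo-* (2 ℕ.^ m) (2 ℕ.^ m) ⟩
    ((2 ℕ.^ m) ℚ-Mult.× 1ℚ) ℚ.* ((2 ℕ.^ m) ℚ-Mult.× 1ℚ) ∎
    where open ≡-Reasoning

  ∣⟪B,B⟫∣≡½^m : ∀ {a₁ a₂} → InSub m a₁ → InSub m a₂ → a₁ ≢ a₂ → ∀ b₁ b₂ →
                ℚ.∣ ⟪ B F m a₁ b₁ , B F m a₂ b₂ ⟫ ∣ ≡ ½^ m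
  ∣⟪B,B⟫∣≡½^m {a₁} {a₂} a₁∈ a₂∈ a₁≢a₂ b₁ b₂ = begin
    ℚ.∣ ⟪ B F m a₁ b₁ , B F m a₂ b₂ ⟫ ∣               ≡⟨ cong ℚ.∣_∣ (⟪B,B⟫≡½^m*½^m*W a₁ a₂ b₁ b₂ a₁∈ a₂∈) ⟩
    ℚ.∣ (½^ m ℚ.* ½^ m) ℚ.* W (a₁ + a₂) (b₁ + b₂) ∣   ≡⟨ ∣h²W∣≡h (½^-nonNeg m) (½^*2^≡1 m) (trans W*W≡ ∑1≡2^m*2^m) ⟩
    ½^ m ∎
    where
    open ≡-Reasoning
    W*W≡ = W*W≡∑1 (b₁ + b₂) (InSub-+ m a₁∈ a₂∈) (a₁≢a₂ ∘ x+y≡0⇒x≡y)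

open import Data.Nat using (_*_)
open import Data.Rational using (∣_∣)

lemma5 : (t r : ℕ) → let m = suc t * suc r in
    (F : GF (2 * m)) → let open GF F in
    (a₁ a₂ : Carrier) → InSub (suc r) a₁ → InSub (suc r) a₂ → ¬ (a₁ ≡ a₂) →
    (b₁ b₂ : Carrier) →
    ∣ ⟪ B F m a₁ b₁ , B F m a₂ b₂ ⟫ ∣ ≡ ½^ m
lemma5 t r F a₁ a₂ a₁∈ a₂∈ a₁≢a₂ =
  QuadraticForm.∣⟪B,B⟫∣≡½^m {suc t * suc r} F (InSub-∣ r∣m a₁∈) (InSub-∣ r∣m a₂∈) a₁≢a₂
  where
  open Field F using (InSub-∣)
  r∣m : suc r ∣ suc t * suc r
  r∣m = divides (suc t) refl
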